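{- For any non-empty finite poset $P$ and any integer $m\ge3$, the poset $A_m\oplus P$ is not LE-cactus.
   Context: For an $n$-element poset $P$, a linear extension is a list $(p_1,\dots,p_n)$ of all elements with $p_a<_P p_b$ implying $a<b$; ${\mathcal{L}}(P)$ is the set of these. The Bender--Knuth move $t_i$ ($1\le i\le n-1$) acts on ${\mathcal{L}}(P)$ by swapping $p_i,p_{i+1}$ if incomparable and fixing the list otherwise; $\mathcal{BK}_P$ is the permutation group they generate. Let $q_m=t_1(t_2t_1)\cdots(t_mt_{m-1}\cdots t_1)$ and $q_{jk}=q_{k-1}q_{k-j}q_{k-1}$. An $n$-element poset is LE-cactus if $(t_iq_{jk})^2=1$ holds in $\mathcal{BK}_P$ for all $2\le i+1<j<k\le n$. $A_m$ denotes an $m$-element antichain, and $A_m\oplus P$ the ordinal sum in which every element of $A_m$ lies below every element of $P$. -}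

module Defs where

open import Data.Nat as ℕ using (ℕ; zero; suc; _+_; _∸_; _≤_; _<_; _≤?_; _<?_)
open import Data.Fin as Fin using (Fin; splitAt; fromℕ<)
open import Data.Fin.Properties using () renaming (_≟_ to _≟ᶠ_)
open import Data.List using (List; []; _∷_; _++_)
open import Data.Sum using (_⊎_; inj₁; inj₂)
open import Data.Unit using (⊤; tt)
open import Data.Empty using (⊥)
open import Data.Product using (_×_; _,_)
open import Relation.Nullary using (¬_; Dec; yes; no)
open import Relation.Nullary.Decidable using (_×-dec_; ¬?)
open import Relation.Binary using (Decidable; IsStrictPartialOrder)
open import Relation.Binary.PropositionalEquality using (_≡_; refl; isEquivalence)
open import Data.Nat.Properties using (<⇒≤)
open import Function.Definitions using (Bijective)

record FinPoset (n : ℕ) : Set₁ where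
  field
    _≺_ : Fin n → Fin n → Set
    isSPO : IsStrictPartialOrder _≡_ _≺_
    _≺?_ : Decidable _≺_
open FinPoset public

-- A list (p_1,…,p_n) of elements is represented as L : Fin n → Fin n
-- (position ↦ element, 0-based positions).
-- Linear extension: every element listed exactly once, and order respected.
IsLinearExtension : ∀ {n} → FinPoset n → (Fin n → Fin n) → Set
IsLinearExtension {n} P L =
  Bijective _≡_ _≡_ L × (∀ a b → _≺_ P (L a) (L b) → a Fin.< b)

Incomparable : ∀ {n} → FinPoset n → Fin n → Fin n → Set
Incomparable P x y = ¬ (_≺_ P x y) × ¬ (_≺_ P y x)

incomparable? : ∀ {n} (P : FinPoset n) → Decidable (Incomparable P)
incomparable? P x y = ¬? (_≺?_ P x y) ×-dec ¬? (_≺?_ P y x)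

swapPos : ∀ {n} → Fin n → Fin n → (Fin n → Fin n) → (Fin n → Fin n)
swapPos a b L x with x ≟ᶠ a
... | yes _ = L b
... | no _ with x ≟ᶠ b
...   | yes _ = L a
...   | no _ = L x

-- Bender–Knuth move t_i (1-based i, 1 ≤ i ≤ n-1): swaps p_i and p_{i+1}
-- (0-based positions i-1 and i) if they are incomparable, else fixes the list.
-- For i outside 1..n-1 it acts as the identity (never used).
t : ∀ {n} → FinPoset n → ℕ → (Fin n → Fin n) → (Fin n → Fin n)
t {n} P zero L = L
t {n} P (suc i) L with suc i <? n
... | no _ = L
... | yes i+1<n with incomparable? P (L (fromℕ< (<⇒≤ i+1<n))) (L (fromℕ< i+1<n))
...   | yes _ = swapPos (fromℕ< (<⇒≤ i+1<n)) (fromℕ< i+1<n) L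
...   | no _ = L

-- A word in the generators t_i, as a list of (1-based) indices;
-- [a₁, …, a_r] denotes the product t_{a₁} ⋯ t_{a_r}, acting as a
-- composition of functions (rightmost factor applied first).
act : ∀ {n} → FinPoset n → List ℕ → (Fin n → Fin n) → (Fin n → Fin n)
act P [] L = L
act P (a ∷ w) L = t P a (act P w L)

desc : ℕ → List ℕ
desc zero = []
desc (suc r) = suc r ∷ desc r

q : ℕ → List ℕ
q zero = []
q (suc m) = q m ++ desc (suc m)

qq : ℕ → ℕ → List ℕ
qq j k = q (k ∸ 1) ++ q (k ∸ j) ++ q (k ∸ 1)

-- P is LE-cactus: (t_i q_{jk})² = 1 in BK_P for all 2 ≤ i+1 < j < k ≤ n,
-- i.e. this word acts as the identity on every linear extension.
IsLECactus : ∀ {n} → FinPoset n → Set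
IsLECactus {n} P =
  ∀ i j k → 2 ≤ suc i → suc i < j → j < k → k ≤ n →
  ∀ (L : Fin n → Fin n) → IsLinearExtension P L →
  ∀ x → act P ((i ∷ qq j k) ++ (i ∷ qq j k)) L x ≡ L x

-- Ordinal sum A_m ⊕ P on Fin (m + n): the first m elements form an
-- antichain, the last n form a copy of P, and every element of A_m lies
-- below every element of P.
⊕-rel : ∀ {m n} → FinPoset n → Fin m ⊎ Fin n → Fin m ⊎ Fin n → Set
⊕-rel P (inj₁ _) (inj₁ _) = ⊥
⊕-rel P (inj₁ _) (inj₂ _) = ⊤
⊕-rel P (inj₂ _) (inj₁ _) = ⊥
⊕-rel P (inj₂ a) (inj₂ b) = _≺_ P a b

⊕-rel? : ∀ {m n} (P : FinPoset n) → Decidable (⊕-rel {m} P)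
⊕-rel? P (inj₁ _) (inj₁ _) = no (λ ())
⊕-rel? P (inj₁ _) (inj₂ _) = yes tt
⊕-rel? P (inj₂ _) (inj₁ _) = no (λ ())
⊕-rel? P (inj₂ a) (inj₂ b) = _≺?_ P a b

⊕-irrefl : ∀ {m n} (P : FinPoset n) (x : Fin m ⊎ Fin n) → ¬ ⊕-rel P x x
⊕-irrefl P (inj₁ _) ()
⊕-irrefl P (inj₂ a) r = IsStrictPartialOrder.irrefl (isSPO P) refl r

⊕-trans : ∀ {m n} (P : FinPoset n) (x y z : Fin m ⊎ Fin n) →
          ⊕-rel P x y → ⊕-rel P y z → ⊕-rel P x z
⊕-trans P (inj₁ _) (inj₁ _) z () _
⊕-trans P (inj₁ _) (inj₂ _) (inj₁ _) _ ()
⊕-trans P (inj₁ _) (inj₂ _) (inj₂ _) _ _ = tt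
⊕-trans P (inj₂ _) (inj₁ _) z () _
⊕-trans P (inj₂ _) (inj₂ _) (inj₁ _) _ ()
⊕-trans P (inj₂ a) (inj₂ b) (inj₂ c) r s = IsStrictPartialOrder.trans (isSPO P) r s

ordinalSum : (m : ℕ) → ∀ {n} → FinPoset n → FinPoset (m + n)
ordinalSum m P = record
  { _≺_ = λ x y → ⊕-rel P (splitAt m x) (splitAt m y)
  ; isSPO = record
    { isEquivalence = isEquivalence
    ; irrefl = λ { {x} refl r → ⊕-irrefl P (splitAt m x) r }
    ; trans = λ {x} {y} {z} → ⊕-trans P (splitAt m x) (splitAt m y) (splitAt m z)
    ; <-resp-≈ = (λ { refl r → r }) , (λ { refl r → r })
    }
  ; _≺?_ = λ x y → ⊕-rel? P (splitAt m x) (splitAt m y)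
  }

A_⊕_ : (m : ℕ) → ∀ {n} → FinPoset n → FinPoset (m + n)
A m ⊕ P = ordinalSum m P

{-# OPTIONS --safe #-}
-- Take i = 1, j = m, k = m + 1 and a linear extension of A_m ⊕ P that lists A_m first and
-- then a linear extension of P (one exists: sort by height, breaking ties by index).
-- On such a list t_a with a < m swaps two elements of A_m, while t_m is trivial because
-- position m − 1 holds an element of A_m and position m one of P. Hence every word in
-- t_1, …, t_m acts through the corresponding permutation of the (0-based) positions below m:
-- q_{m−1} reverses them and q_m acts as q_{m−1} t_{m−1} ⋯ t_1. In these terms
-- (t_1 q_{m,m+1})² brings the entry at position m − 1 to position 0, which for m ≥ 3 is a
-- genuine move.
module Submission where

open import Defs
open import Level using (0ℓ)
open import Data.Nat as ℕ using (ℕ; zero; suc; _+_; _∸_; _≤_; _<_; _<?_; z≤n; s≤s)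
open import Data.Nat.Properties as ℕ
  using (≤-refl; ≤-antisym; ≮⇒≥; <⇒≤; <⇒≢; >⇒≢; n<1+n; <-trans; <-irrefl; <-≤-trans;
         1+n≰n; m≤n⇒m≤1+n; m≤n⇒m<n∨m≡n; m≤m+n; m<m+n; +-monoʳ-<; +-∸-assoc; n∸n≡0; m∸n≤m; m+n∸n≡m)
open import Data.Fin as Fin using (Fin; toℕ; fromℕ<; punchOut; combine; splitAt; join)
open import Data.Fin.Properties as Fin
  using (toℕ-injective; toℕ-fromℕ<; injective⇒≤; punchOut-injective; any?;
         combine-monoˡ-<; combine-injectiveʳ; splitAt-join; join-splitAt; splitAt-<; splitAt-≥;
         toℕ-↑ˡ; toℕ-↑ʳ; toℕ<n; +↔⊎)
open import Data.Fin.Subset using (Subset; _∈_; _∉_; ∣_∣)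
open import Data.Fin.Subset.Properties using (p⊂q⇒∣p∣<∣q∣; ∣⊤∣≡n; ⊆⊤; ∈⊤)
open import Data.Vec using (tabulate)
open import Data.Vec.Properties using (lookup∘tabulate; lookup⇒[]=; []=⇒lookup)
open import Data.List using (List; []; _∷_; _++_)
open import Data.List.Relation.Unary.All as All using (All; []; _∷_)
open import Data.List.Relation.Unary.All.Properties using (++⁺)
open import Data.Sum as Sum using (inj₁; inj₂)
open import Data.Sum.Properties using (inj₂-injective)
open import Data.Unit using (tt)
open import Data.Product using (∃; _×_; _,_; proj₁; proj₂)
open import Function using (_∘_; _∘′_)
open import Function.Bundles using (Bijection)
open import Function.Definitions using (Injective; Surjective; Bijective)
open import Function.Properties.Inverse using (↔⇒⤖; ↔-sym)
import Function.Construct.Composition as Comp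
open import Relation.Binary
  using (Rel; Decidable; Irreflexive; Transitive; Trichotomous; tri<; tri≈; tri>; IsStrictPartialOrder)
open import Relation.Binary.PropositionalEquality
  using (_≡_; _≢_; refl; sym; trans; cong; subst; subst₂; module ≡-Reasoning)
open import Relation.Nullary using (¬_; yes; no; does; contradiction)
open import Relation.Nullary.Decidable using (dec-true)

injective⇒surjective : ∀ {n} {f : Fin n → Fin n} → Injective _≡_ _≡_ f →
                       ∀ y → ∃ λ x → f x ≡ y
injective⇒surjective {suc n} {f} f-inj y with any? (λ x → f x Fin.≟ y)
... | yes hit = hit
... | no miss = contradiction (injective⇒≤ {f = punchOut ∘ y≢f} punchOut∘y≢f-inj) 1+n≰n
  where
  y≢f : ∀ x → y ≢ f x
  y≢f x y≡fx = miss (x , sym y≡fx)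
  punchOut∘y≢f-inj : Injective _≡_ _≡_ (punchOut ∘ y≢f)
  punchOut∘y≢f-inj e = f-inj (punchOut-injective (y≢f _) (y≢f _) e)

module Height {n : ℕ} {_⊏_ : Rel (Fin n) 0ℓ} (_⊏?_ : Decidable _⊏_)
              (⊏-irrefl : Irreflexive _≡_ _⊏_) (⊏-trans : Transitive _⊏_) where

  below : Fin n → Subset n
  below x = tabulate λ y → does (y ⊏? x)

  ∈-below⁺ : ∀ {x y} → y ⊏ x → y ∈ below x
  ∈-below⁺ {x} {y} y⊏x = lookup⇒[]= y (below x) (trans (lookup∘tabulate _ y) (dec-true (y ⊏? x) y⊏x))

  ∈-below⁻ : ∀ {x y} → y ∈ below x → y ⊏ x
  ∈-below⁻ {x} {y} y∈ with y ⊏? x | trans (sym (lookup∘tabulate _ y)) ([]=⇒lookup y∈)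
  ... | yes y⊏x | _ = y⊏x
  ... | no _    | ()

  ∉-below-self : ∀ x → x ∉ below x
  ∉-below-self x = ⊏-irrefl refl ∘ ∈-below⁻

  height : Fin n → ℕ
  height x = ∣ below x ∣

  height-mono : ∀ {x y} → x ⊏ y → height x < height y
  height-mono {x} x⊏y = p⊂q⇒∣p∣<∣q∣
    ((∈-below⁺ ∘ (λ z⊏x → ⊏-trans z⊏x x⊏y) ∘ ∈-below⁻) , x , ∈-below⁺ x⊏y , ∉-below-self x)

  height<n : ∀ x → height x < n
  height<n x = subst (height x <_) (∣⊤∣≡n n) (p⊂q⇒∣p∣<∣q∣ (⊆⊤ , x , ∈⊤ , ∉-below-self x))

  height-injective : Trichotomous _≡_ _⊏_ → Injective _≡_ _≡_ height
  height-injective compare {x} {y} hx≡hy with compare x y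
  ... | tri< x⊏y _ _ = contradiction hx≡hy (<⇒≢ (height-mono x⊏y))
  ... | tri≈ _ x≡y _ = x≡y
  ... | tri> _ _ y⊏x = contradiction (sym hx≡hy) (<⇒≢ (height-mono y⊏x))

  heightᶠ : Fin n → Fin n
  heightᶠ x = fromℕ< (height<n x)

  toℕ-heightᶠ : ∀ x → toℕ (heightᶠ x) ≡ height x
  toℕ-heightᶠ x = toℕ-fromℕ< (height<n x)

  heightᶠ-mono : ∀ {x y} → x ⊏ y → heightᶠ x Fin.< heightᶠ y
  heightᶠ-mono x⊏y = subst₂ _<_ (sym (toℕ-heightᶠ _)) (sym (toℕ-heightᶠ _)) (height-mono x⊏y)

  heightᶠ-injective : Trichotomous _≡_ _⊏_ → Injective _≡_ _≡_ heightᶠ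
  heightᶠ-injective compare {x} {y} e =
    height-injective compare (trans (sym (toℕ-heightᶠ x)) (trans (cong toℕ e) (toℕ-heightᶠ y)))

linearExtension-fromRanking : ∀ {n} (P : FinPoset n) (rank : Fin n → Fin n) →
  Injective _≡_ _≡_ rank → (∀ {x y} → _≺_ P x y → rank x Fin.< rank y) →
  ∃ (IsLinearExtension P)
linearExtension-fromRanking {n} P rank rank-inj rank-mono =
  L , ((L-inj , λ e → rank e , λ { refl → rank-inj (L-section (rank e)) }) , L-ordered)
  where
  L : Fin n → Fin n
  L = proj₁ ∘ injective⇒surjective rank-inj
  L-section : ∀ p → rank (L p) ≡ p
  L-section = proj₂ ∘ injective⇒surjective rank-inj
  L-inj : Injective _≡_ _≡_ L
  L-inj {p} {p′} e = trans (sym (L-section p)) (trans (cong rank e) (L-section p′))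
  L-ordered : ∀ p p′ → _≺_ P (L p) (L p′) → p Fin.< p′
  L-ordered p p′ r = subst₂ Fin._<_ (L-section p) (L-section p′) (rank-mono r)

linearExtension : ∀ {n} (P : FinPoset n) → ∃ (IsLinearExtension P)
linearExtension {n} P =
  linearExtension-fromRanking P H⊏.heightᶠ (H⊏.heightᶠ-injective ⊏-compare)
    (λ x≺y → H⊏.heightᶠ-mono (combine-monoˡ-< _ _ (H≺.heightᶠ-mono x≺y)))
  where
  open IsStrictPartialOrder (isSPO P) using () renaming (irrefl to ≺-irrefl; trans to ≺-trans)
  module H≺ = Height (_≺?_ P) ≺-irrefl ≺-trans
  -- toℕ (key x) = n · height x + toℕ x: sort by height, break ties by index.
  key : Fin n → Fin (n ℕ.* n)
  key x = combine (H≺.heightᶠ x) x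
  _⊏_ : Rel (Fin n) 0ℓ
  x ⊏ y = key x Fin.< key y
  ⊏-compare : Trichotomous _≡_ _⊏_
  ⊏-compare x y with Fin.<-cmp (key x) (key y)
  ... | tri< lt ≢ ≯ = tri< lt (≢ ∘ cong key) ≯
  ... | tri≈ ≮ eq ≯ = tri≈ ≮ (combine-injectiveʳ (H≺.heightᶠ x) x (H≺.heightᶠ y) y eq) ≯
  ... | tri> ≮ ≢ gt = tri> ≮ (≢ ∘ cong key) gt
  _⊏?_ : Decidable _⊏_
  x ⊏? y = key x Fin.<? key y
  ⊏-irrefl : Irreflexive _≡_ _⊏_
  ⊏-irrefl = Fin.<-irrefl ∘ cong key
  module H⊏ = Height _⊏?_ ⊏-irrefl Fin.<-trans

swapAdj : ℕ → ℕ → ℕ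
swapAdj zero    zero          = 1
swapAdj zero    (suc zero)    = 0
swapAdj zero    (suc (suc x)) = suc (suc x)
swapAdj (suc a) zero          = zero
swapAdj (suc a) (suc x)       = suc (swapAdj a x)

swapAdj-self : ∀ a → swapAdj a a ≡ suc a
swapAdj-self zero    = refl
swapAdj-self (suc a) = cong suc (swapAdj-self a)

swapAdj-suc : ∀ a → swapAdj a (suc a) ≡ a
swapAdj-suc zero    = refl
swapAdj-suc (suc a) = cong suc (swapAdj-suc a)

swapAdj-fixes : ∀ {a x} → x ≢ a → x ≢ suc a → swapAdj a x ≡ x
swapAdj-fixes {zero}  {zero}          x≢a _    = contradiction refl x≢a
swapAdj-fixes {zero}  {suc zero}      _   x≢sa = contradiction refl x≢sa
swapAdj-fixes {zero}  {suc (suc x)}   _   _    = refl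
swapAdj-fixes {suc a} {zero}          _   _    = refl
swapAdj-fixes {suc a} {suc x}         x≢a x≢sa =
  cong suc (swapAdj-fixes (x≢a ∘′ cong suc) (x≢sa ∘′ cong suc))

module WordAction (m : ℕ) where

  letterAction : ℕ → ℕ → ℕ
  letterAction zero    x = x
  letterAction (suc a) x with suc a <? m
  ... | yes _ = swapAdj a x
  ... | no  _ = x

  letterAction-inner : ∀ {a} → suc a < m → ∀ x → letterAction (suc a) x ≡ swapAdj a x
  letterAction-inner {a} a<m x with suc a <? m
  ... | yes _   = refl
  ... | no  a≮m = contradiction a<m a≮m

  letterAction-outer : ∀ {a} → ¬ suc a < m → ∀ x → letterAction (suc a) x ≡ x
  letterAction-outer {a} a≮m x with suc a <? m
  ... | yes a<m = contradiction a<m a≮m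
  ... | no  _   = refl

  wordAction : List ℕ → ℕ → ℕ
  wordAction []      x = x
  wordAction (a ∷ w) x = wordAction w (letterAction a x)

  wordAction-++ : ∀ u v x → wordAction (u ++ v) x ≡ wordAction v (wordAction u x)
  wordAction-++ []      v x = refl
  wordAction-++ (a ∷ u) v x = wordAction-++ u v (letterAction a x)

  Confined : (ℕ → ℕ) → Set
  Confined g = (∀ x → x < m → g x < m) × (∀ x → m ≤ x → g x ≡ x)

  letterAction-confined : ∀ a → Confined (letterAction a)
  letterAction-confined zero = (λ _ x<m → x<m) , (λ _ _ → refl)
  letterAction-confined (suc a) with suc a <? m
  ... | no  _   = (λ _ x<m → x<m) , (λ _ _ → refl)
  ... | yes a<m = below , above
    where
    below : ∀ x → x < m → swapAdj a x < m
    below x x<m with x ℕ.≟ a | x ℕ.≟ suc a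
    ... | yes refl | _        = subst (_< m) (sym (swapAdj-self x)) a<m
    ... | no  _    | yes refl = subst (_< m) (sym (swapAdj-suc a)) (<-trans (n<1+n a) a<m)
    ... | no  x≢a  | no x≢sa  = subst (_< m) (sym (swapAdj-fixes x≢a x≢sa)) x<m
    above : ∀ x → m ≤ x → swapAdj a x ≡ x
    above x m≤x = swapAdj-fixes (>⇒≢ (<-trans (n<1+n a) (<-≤-trans a<m m≤x)))
                                (>⇒≢ (<-≤-trans a<m m≤x))

  wordAction-confined : ∀ w → Confined (wordAction w)
  wordAction-confined []      = (λ _ x<m → x<m) , (λ _ _ → refl)
  wordAction-confined (a ∷ w) =
    (λ x x<m → proj₁ (wordAction-confined w) _ (proj₁ (letterAction-confined a) x x<m)) ,
    (λ x m≤x → trans (cong (wordAction w) (proj₂ (letterAction-confined a) x m≤x))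
                     (proj₂ (wordAction-confined w) x m≤x))

  desc-step : ∀ {r} → suc r < m → ∀ x →
              wordAction (desc (suc r)) x ≡ wordAction (desc r) (swapAdj r x)
  desc-step {r} sr<m x = cong (wordAction (desc r)) (letterAction-inner sr<m x)

  desc-wraps : ∀ r → r < m → wordAction (desc r) r ≡ 0
  desc-wraps zero    _    = refl
  desc-wraps (suc r) sr<m = trans (desc-step sr<m (suc r))
    (trans (cong (wordAction (desc r)) (swapAdj-suc r)) (desc-wraps r (<⇒≤ sr<m)))

  desc-fixes : ∀ r → r < m → ∀ {x} → r < x → wordAction (desc r) x ≡ x
  desc-fixes zero    _    _    = refl
  desc-fixes (suc r) sr<m {x} sr<x = trans (desc-step sr<m x)
    (trans (cong (wordAction (desc r)) (swapAdj-fixes (>⇒≢ (<⇒≤ sr<x)) (>⇒≢ sr<x)))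
           (desc-fixes r (<⇒≤ sr<m) (<⇒≤ sr<x)))

  desc-shifts : ∀ r → r < m → ∀ {x} → x < r → wordAction (desc r) x ≡ suc x
  desc-shifts (suc r) sr<m {x} (s≤s x≤r) with m≤n⇒m<n∨m≡n x≤r
  ... | inj₁ x<r  = trans (desc-step sr<m x)
    (trans (cong (wordAction (desc r)) (swapAdj-fixes (<⇒≢ x<r) (<⇒≢ (<-trans x<r (n<1+n r)))))
           (desc-shifts r (<⇒≤ sr<m) x<r))
  ... | inj₂ refl = trans (desc-step sr<m x)
    (trans (cong (wordAction (desc x)) (swapAdj-self x))
           (desc-fixes x (<⇒≤ sr<m) (n<1+n x)))

  q-fixes : ∀ r → r < m → ∀ {x} → r < x → wordAction (q r) x ≡ x
  q-fixes zero    _    _    = refl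
  q-fixes (suc r) sr<m {x} sr<x = trans (wordAction-++ (q r) (desc (suc r)) x)
    (trans (cong (wordAction (desc (suc r))) (q-fixes r (<⇒≤ sr<m) (<⇒≤ sr<x)))
           (desc-fixes (suc r) sr<m sr<x))

  q-reverses : ∀ r → r < m → ∀ {x} → x ≤ r → wordAction (q r) x ≡ r ∸ x
  q-reverses zero    _    z≤n = refl
  q-reverses (suc r) sr<m {x} x≤sr with m≤n⇒m<n∨m≡n x≤sr
  ... | inj₁ (s≤s x≤r) = trans (wordAction-++ (q r) (desc (suc r)) x)
    (trans (cong (wordAction (desc (suc r))) (q-reverses r (<⇒≤ sr<m) x≤r))
    (trans (desc-shifts (suc r) sr<m (s≤s (m∸n≤m r x))) (sym (+-∸-assoc 1 x≤r))))
  ... | inj₂ refl = trans (wordAction-++ (q r) (desc (suc r)) x)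
    (trans (cong (wordAction (desc (suc r))) (q-fixes r (<⇒≤ sr<m) (n<1+n r)))
    (trans (desc-wraps (suc r) sr<m) (sym (n∸n≡0 (suc r)))))

open WordAction

desc-letters : ∀ r → All (_≤ r) (desc r)
desc-letters zero    = []
desc-letters (suc r) = ≤-refl ∷ All.map m≤n⇒m≤1+n (desc-letters r)

q-letters : ∀ r → All (_≤ r) (q r)
q-letters zero    = []
q-letters (suc r) = ++⁺ (All.map m≤n⇒m≤1+n (q-letters r)) (desc-letters (suc r))

q-last : ∀ r {x} → x ≤ r → wordAction (suc r) (q (suc r)) x ≡ wordAction (suc r) (desc r) (r ∸ x)
q-last r {x} x≤r = begin
  wordAction (suc r) (q (suc r)) x
    ≡⟨ wordAction-++ (suc r) (q r) (desc (suc r)) x ⟩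
  wordAction (suc r) (desc r) (letterAction (suc r) (suc r) (wordAction (suc r) (q r) x))
    ≡⟨ cong (wordAction (suc r) (desc r)) (letterAction-outer (suc r) (<-irrefl refl) _) ⟩
  wordAction (suc r) (desc r) (wordAction (suc r) (q r) x)
    ≡⟨ cong (wordAction (suc r) (desc r)) (q-reverses (suc r) r (n<1+n r) x≤r) ⟩
  wordAction (suc r) (desc r) (r ∸ x) ∎
  where open ≡-Reasoning

cactusWord : ℕ → ℕ → ℕ → List ℕ
cactusWord i j k = (i ∷ qq j k) ++ (i ∷ qq j k)

module _ (k : ℕ) where
  private
    r m : ℕ
    r = suc (suc k)
    m = suc r
    ρ : ℕ → ℕ
    ρ = wordAction m (q m)

  ρ-0 : ρ 0 ≡ 0
  ρ-0 = trans (q-last r z≤n) (desc-wraps m r (n<1+n r))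

  ρ-1 : ρ 1 ≡ r
  ρ-1 = trans (q-last r (s≤s z≤n)) (desc-shifts m r (n<1+n r) (n<1+n (suc k)))

  ρ-r : ρ r ≡ 1
  ρ-r = trans (q-last r ≤-refl)
    (trans (cong (wordAction m (desc r)) (n∸n≡0 r)) (desc-shifts m r (n<1+n r) (s≤s z≤n)))

  q-one : ∀ x → wordAction m (q (suc m ∸ m)) x ≡ swapAdj 0 x
  q-one x rewrite m+n∸n≡m 1 m = letterAction-inner m (s≤s (s≤s z≤n)) x

  cactusHalf : ∀ x → wordAction m (1 ∷ qq m (suc m)) x ≡ ρ (swapAdj 0 (ρ (swapAdj 0 x)))
  cactusHalf x = begin
    wordAction m (q m ++ q (suc m ∸ m) ++ q m) (letterAction m 1 x)
      ≡⟨ cong (wordAction m (q m ++ q (suc m ∸ m) ++ q m)) (letterAction-inner m (s≤s (s≤s z≤n)) x) ⟩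
    wordAction m (q m ++ q (suc m ∸ m) ++ q m) (swapAdj 0 x)
      ≡⟨ wordAction-++ m (q m) (q (suc m ∸ m) ++ q m) _ ⟩
    wordAction m (q (suc m ∸ m) ++ q m) (ρ (swapAdj 0 x))
      ≡⟨ wordAction-++ m (q (suc m ∸ m)) (q m) _ ⟩
    ρ (wordAction m (q (suc m ∸ m)) (ρ (swapAdj 0 x)))
      ≡⟨ cong ρ (q-one _) ⟩
    ρ (swapAdj 0 (ρ (swapAdj 0 x))) ∎
    where open ≡-Reasoning

  cactusWord-moves-first : wordAction m (cactusWord 1 m (suc m)) 0 ≡ r
  cactusWord-moves-first = begin
    wordAction m (cactusWord 1 m (suc m)) 0
      ≡⟨ wordAction-++ m (1 ∷ qq m (suc m)) (1 ∷ qq m (suc m)) 0 ⟩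
    wordAction m (1 ∷ qq m (suc m)) (wordAction m (1 ∷ qq m (suc m)) 0)
      ≡⟨ cong (wordAction m (1 ∷ qq m (suc m))) (trans (cactusHalf 0) (cong (ρ ∘′ swapAdj 0) ρ-1)) ⟩
    wordAction m (1 ∷ qq m (suc m)) (ρ r)
      ≡⟨ cong (wordAction m (1 ∷ qq m (suc m))) ρ-r ⟩
    wordAction m (1 ∷ qq m (suc m)) 1
      ≡⟨ cactusHalf 1 ⟩
    ρ (swapAdj 0 (ρ 0))
      ≡⟨ cong (ρ ∘′ swapAdj 0) ρ-0 ⟩
    ρ 1
      ≡⟨ ρ-1 ⟩
    r ∎
    where open ≡-Reasoning

  cactusWord-letters : All (_≤ m) (cactusWord 1 m (suc m))
  cactusWord-letters = ++⁺ half half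
    where
    q-one-letters : All (_≤ m) (q (suc m ∸ m))
    q-one-letters rewrite m+n∸n≡m 1 m = s≤s z≤n ∷ []
    half : All (_≤ m) (1 ∷ qq m (suc m))
    half = s≤s z≤n ∷ ++⁺ (q-letters m) (++⁺ q-one-letters (q-letters m))

-- Positions are tracked in ℕ so that permutations of them can be computed without bound proofs.
Reindexes : ∀ {N} → (ℕ → ℕ) → (Fin N → Fin N) → (Fin N → Fin N) → Set
Reindexes g L′ L = ∀ x → ∃ λ y → toℕ y ≡ g (toℕ x) × L′ x ≡ L y

reindexes-∘ : ∀ {N} {g h : ℕ → ℕ} {L L′ L″ : Fin N → Fin N} →
              Reindexes g L′ L → Reindexes h L″ L′ → Reindexes (g ∘ h) L″ L
reindexes-∘ {g = g} L′≈L L″≈L′ x with L″≈L′ x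
... | y , y≡hx , L″x≡L′y with L′≈L y
...   | z , z≡gy , L′y≡Lz = z , trans z≡gy (cong g y≡hx) , trans L″x≡L′y L′y≡Lz

swapPos-adjacent : ∀ {N} {i j : Fin N} {a} → toℕ i ≡ a → toℕ j ≡ suc a → ∀ L →
                   Reindexes (swapAdj a) (swapPos i j L) L
swapPos-adjacent {i = i} {j} {a} i≡a j≡sa L x with x Fin.≟ i
... | yes refl = j , trans j≡sa (sym (trans (cong (swapAdj a) i≡a) (swapAdj-self a))) , refl
... | no x≢i with x Fin.≟ j
...   | yes refl = i , trans i≡a (sym (trans (cong (swapAdj a) j≡sa) (swapAdj-suc a))) , refl
...   | no x≢j = x , sym (swapAdj-fixes (x≢i ∘ toℕ-injective ∘ (λ e → trans e (sym i≡a)))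
                                        (x≢j ∘ toℕ-injective ∘ (λ e → trans e (sym j≡sa)))) , refl

map₂-bijective : ∀ {A B : Set} {f : B → B} → Bijective _≡_ _≡_ f →
                 Bijective _≡_ _≡_ (Sum.map₂ {A = A} f)
map₂-bijective {f = f} (f-inj , f-surj) = inj , surj
  where
  inj : Injective _≡_ _≡_ (Sum.map₂ f)
  inj {inj₁ _} {inj₁ _} refl = refl
  inj {inj₂ _} {inj₂ _} e    = cong inj₂ (f-inj (inj₂-injective e))
  surj : Surjective _≡_ _≡_ (Sum.map₂ f)
  surj (inj₁ a) = inj₁ a , λ { refl → refl }
  surj (inj₂ b) with f-surj b
  ... | x , fx≡b = inj₂ x , λ { refl → cong inj₂ (fx≡b refl) }

module _ (m : ℕ) {n : ℕ} (P : FinPoset n) where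

  antichainFirst : (Fin n → Fin n) → Fin (m + n) → Fin (m + n)
  antichainFirst L = join m n ∘ Sum.map₂ L ∘ splitAt m

  splitAt-antichainFirst : ∀ L x → splitAt m (antichainFirst L x) ≡ Sum.map₂ L (splitAt m x)
  splitAt-antichainFirst L x = splitAt-join m n (Sum.map₂ L (splitAt m x))

  antichainFirst-bijective : ∀ {L} → Bijective _≡_ _≡_ L → Bijective _≡_ _≡_ (antichainFirst L)
  antichainFirst-bijective L-bij =
    Comp.bijective _≡_ _≡_ _≡_ (Bijection.bijective (↔⇒⤖ +↔⊎))
      (Comp.bijective _≡_ _≡_ _≡_ (map₂-bijective L-bij) (Bijection.bijective (↔⇒⤖ (↔-sym +↔⊎))))

  join-ordered : ∀ {L} → (∀ a b → _≺_ P (L a) (L b) → a Fin.< b) →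
                 ∀ s s′ → ⊕-rel P (Sum.map₂ L s) (Sum.map₂ L s′) → join m n s Fin.< join m n s′
  join-ordered _ (inj₁ i) (inj₂ j) _ = subst₂ _<_ (sym (toℕ-↑ˡ i n)) (sym (toℕ-↑ʳ m j))
                                         (<-≤-trans (toℕ<n i) (m≤m+n m (toℕ j)))
  join-ordered L-ordered (inj₂ i) (inj₂ j) Li≺Lj = subst₂ _<_ (sym (toℕ-↑ʳ m i)) (sym (toℕ-↑ʳ m j))
                                                     (+-monoʳ-< m (L-ordered i j Li≺Lj))

  antichainFirst-linear : ∀ {L} → IsLinearExtension P L →
                          IsLinearExtension (A m ⊕ P) (antichainFirst L)
  antichainFirst-linear {L} (L-bij , L-ordered) = antichainFirst-bijective L-bij , ordered
    where
    ordered : ∀ a b → _≺_ (A m ⊕ P) (antichainFirst L a) (antichainFirst L b) → a Fin.< b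
    ordered a b r = subst₂ Fin._<_ (join-splitAt m n a) (join-splitAt m n b)
      (join-ordered L-ordered (splitAt m a) (splitAt m b)
        (subst₂ (⊕-rel P) (splitAt-antichainFirst L a) (splitAt-antichainFirst L b) r))

  InA InP : Fin (m + n) → Set
  InA e = ∃ λ i → splitAt m e ≡ inj₁ i
  InP e = ∃ λ j → splitAt m e ≡ inj₂ j

  Layered : (Fin (m + n) → Fin (m + n)) → Set
  Layered L = ∀ x → (toℕ x < m → InA (L x)) × (m ≤ toℕ x → InP (L x))

  antichainFirst-layered : ∀ L → Layered (antichainFirst L)
  antichainFirst-layered L x =
    (λ x<m → _ , trans (splitAt-antichainFirst L x) (cong (Sum.map₂ L) (splitAt-< m x x<m))) ,
    (λ m≤x → _ , trans (splitAt-antichainFirst L x) (cong (Sum.map₂ L) (splitAt-≥ m x m≤x)))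

  reindexes-layered : ∀ {g L L′} → Confined m g → Layered L → Reindexes g L′ L → Layered L′
  reindexes-layered {g} (g-below , g-above) L-layered L′≈L x with L′≈L x
  ... | y , y≡gx , L′x≡Ly =
    (λ x<m → subst InA (sym L′x≡Ly)
               (proj₁ (L-layered y) (subst (_< m) (sym y≡gx) (g-below _ x<m)))) ,
    (λ m≤x → subst InP (sym L′x≡Ly)
               (proj₂ (L-layered y) (subst (m ≤_) (sym (trans y≡gx (g-above _ m≤x))) m≤x)))

  InA-incomparable : ∀ {e e′} → InA e → InA e′ → Incomparable (A m ⊕ P) e e′
  InA-incomparable (i , e≡i) (j , e′≡j) =
    (λ r → subst₂ (⊕-rel P) e≡i e′≡j r) , (λ r → subst₂ (⊕-rel P) e′≡j e≡i r)

  InA-below-InP : ∀ {e e′} → InA e → InP e′ → _≺_ (A m ⊕ P) e e′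
  InA-below-InP (_ , e≡i) (_ , e′≡j) = subst₂ (⊕-rel P) (sym e≡i) (sym e′≡j) tt

  t-reindexes : ∀ {L} → Layered L → ∀ {a} → a ≤ m → Reindexes (letterAction m a) (t (A m ⊕ P) a L) L
  t-reindexes _ {zero} _ x = x , refl , refl
  t-reindexes {L} L-layered {suc a} sa≤m x with suc a <? m + n
  ... | no sa≮N =
    x , sym (letterAction-outer m (sa≮N ∘ λ sa<m → <-≤-trans sa<m (m≤m+n m n)) (toℕ x)) , refl
  ... | yes sa<N with incomparable? (A m ⊕ P) (L (fromℕ< (<⇒≤ sa<N))) (L (fromℕ< sa<N)) | suc a <? m
  ...   | yes _      | yes _     = swapPos-adjacent (toℕ-fromℕ< (<⇒≤ sa<N)) (toℕ-fromℕ< sa<N) L x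
  ...   | yes incomp | no sa≮m   = contradiction (InA-below-InP lastA firstP) (proj₁ incomp)
    where
    sa≡m : suc a ≡ m
    sa≡m = ≤-antisym sa≤m (≮⇒≥ sa≮m)
    lastA : InA (L (fromℕ< (<⇒≤ sa<N)))
    lastA = proj₁ (L-layered _) (subst (_< m) (sym (toℕ-fromℕ< (<⇒≤ sa<N))) sa≤m)
    firstP : InP (L (fromℕ< sa<N))
    firstP = proj₂ (L-layered _) (subst (m ≤_) (sym (trans (toℕ-fromℕ< sa<N) sa≡m)) ≤-refl)
  ...   | no comp    | yes sa<m  = contradiction (InA-incomparable inA₁ inA₂) comp
    where
    inA₁ : InA (L (fromℕ< (<⇒≤ sa<N)))
    inA₁ = proj₁ (L-layered _) (subst (_< m) (sym (toℕ-fromℕ< (<⇒≤ sa<N))) (<⇒≤ sa<m))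
    inA₂ : InA (L (fromℕ< sa<N))
    inA₂ = proj₁ (L-layered _) (subst (_< m) (sym (toℕ-fromℕ< sa<N)) sa<m)
  ...   | no _       | no _      = x , refl , refl

  act-reindexes : ∀ {L} → Layered L → ∀ w → All (_≤ m) w →
                  Reindexes (wordAction m w) (act (A m ⊕ P) w L) L
  act-reindexes _ [] [] x = x , refl , refl
  act-reindexes {L} L-layered (a ∷ w) (a≤m ∷ w≤m) =
    reindexes-∘ {g = wordAction m w} {h = letterAction m a} wL≈L
    (t-reindexes (reindexes-layered (wordAction-confined m w) L-layered wL≈L) a≤m)
    where
    wL≈L : Reindexes (wordAction m w) (act (A m ⊕ P) w L) L
    wL≈L = act-reindexes L-layered w w≤m

cactusWord-displaces : ∀ k {n} (P : FinPoset n) {L} → IsLinearExtension P L →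
  let m = 3 + k
      L₀ = antichainFirst m P L
  in act (A m ⊕ P) (cactusWord 1 m (suc m)) L₀ Fin.zero ≢ L₀ Fin.zero
cactusWord-displaces k P {L} L-linear W≡id
  with act-reindexes (3 + k) P (antichainFirst-layered (3 + k) P L) (cactusWord 1 (3 + k) (4 + k))
                     (cactusWord-letters k) Fin.zero
... | y , toℕy≡W0 , W≡Ly =
  0≢2+k (trans (cong toℕ (sym y≡0)) (trans toℕy≡W0 (cactusWord-moves-first k)))
  where
  y≡0 : y ≡ Fin.zero
  y≡0 = proj₁ (proj₁ (antichainFirst-linear (3 + k) P L-linear)) (trans (sym W≡Ly) W≡id)
  0≢2+k : 0 ≢ suc (suc k)
  0≢2+k ()

proposition3p20 : (m n : ℕ) → 3 ≤ m → 1 ≤ n → (P : FinPoset n) →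
    ¬ IsLECactus (A m ⊕ P)
proposition3p20 m@(suc (suc (suc k))) (suc n) (s≤s (s≤s (s≤s _))) _ P isCactus =
  let E , E-linear = linearExtension P in
  cactusWord-displaces k P E-linear
    (isCactus 1 m (suc m) (s≤s (s≤s z≤n)) (s≤s (s≤s (s≤s z≤n))) (n<1+n m) (m<m+n m (s≤s z≤n))
              _ (antichainFirst-linear m P E-linear) Fin.zero)
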